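{- Let $(\Omega,S)$ be a regular thin Jordan scheme, fix $\omega_0\in\Omega$, and define $\diamond$ on $S$ by: $a\diamond b$ is the unique $c\in S$ with $c(\omega_0)=a(b(\omega_0))$. Then: (1) $1_\Omega$ is a neutral element of $(S,\diamond)$; (2) $a^t\diamond a=1_\Omega$ for all $a\in S$; (3) $a^t\diamond(a\diamond b)=b$ for all $a,b\in S$; (4) for all $a,b\in S$ the equation $x\diamond a=b$ has a unique solution $x\in S$.
   Context: $\Omega$ is a finite nonempty set, $\mathbb{F}$ a field with $\mathrm{char}\,\mathbb{F}\neq2$, $A\star B=\tfrac12(AB+BA)$. A regular thin Jordan scheme $(\Omega,S)$ here means: $S$ is a set of permutations of $\Omega$, each regarded as the binary relation $\{(\omega,s(\omega)):\omega\in\Omega\}$, such that these relations partition $\Omega\times\Omega$, the identity permutation $1_\Omega$ lies in $S$, $s^{ -1}\in S$ for every $s\in S$, and the $\mathbb{F}$-span of the permutation matrices $\underline{s}$ ($(\alpha,\beta)$-entry $1$ iff $\beta=s(\alpha)$), $s\in S$, is closed under $\star$. For $s\in S$, $s^t$ denotes the transposed relation, i.e. $s^t=s^{ -1}$. -}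

module Defs where

open import Level using (Level; _⊔_) renaming (suc to lsuc)
open import Data.Nat using (ℕ)
open import Data.Fin using (Fin; zero; suc; _≟_)
open import Data.Fin.Permutation using (Permutation′; _⟨$⟩ʳ_; _⟨$⟩ˡ_)
open import Data.Product using (Σ; ∃; ∃!; _×_; _,_; proj₁)
open import Relation.Nullary using (¬_; yes; no)
open import Relation.Binary.PropositionalEquality using (_≡_)
open import Algebra.Bundles using (CommutativeRing)

record Field (c ℓ : Level) : Set (lsuc (c ⊔ ℓ)) where
  field
    commutativeRing : CommutativeRing c ℓ
  open CommutativeRing commutativeRing public
  field
    _⁻¹      : Carrier → Carrier
    0≉1      : ¬ (0# ≈ 1#)
    ⁻¹-inverse : ∀ x → ¬ (x ≈ 0#) → x * (x ⁻¹) ≈ 1#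

CharNot2 : ∀ {c ℓ} → Field c ℓ → Set ℓ
CharNot2 F = ¬ (1# + 1# ≈ 0#)
  where open Field F

module MatrixOps {c ℓ} (F : Field c ℓ) where
  open Field F using (Carrier; _≈_; _+_; _*_; 0#; 1#; _⁻¹)

  Σ[_] : ∀ k → (Fin k → Carrier) → Carrier
  Σ[ ℕ.zero ] f = 0#
  Σ[ ℕ.suc k ] f = f Fin.zero + Σ[ k ] (λ i → f (Fin.suc i))

  Mat : ℕ → Set c
  Mat n = Fin n → Fin n → Carrier

  _≈M_ : ∀ {n} → Mat n → Mat n → Set ℓ
  A ≈M B = ∀ α β → A α β ≈ B α β

  _·_ : ∀ {n} → Mat n → Mat n → Mat n
  _·_ {n} A B α γ = Σ[ n ] (λ β → A α β * B β γ)

  _⊕_ : ∀ {n} → Mat n → Mat n → Mat n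
  (A ⊕ B) α β = A α β + B α β

  _⊙_ : ∀ {n} → Carrier → Mat n → Mat n
  (x ⊙ A) α β = x * A α β

  _⋆_ : ∀ {n} → Mat n → Mat n → Mat n
  A ⋆ B = ((1# + 1#) ⁻¹) ⊙ ((A · B) ⊕ (B · A))

  permMat : ∀ {n} → Permutation′ n → Mat n
  permMat s α β with β ≟ (s ⟨$⟩ʳ α)
  ... | yes _ = 1#
  ... | no  _ = 0#

-- A regular thin Jordan scheme on Ω = Fin n over the field F.
-- S is given as a family of permutations indexed by Fin m (distinct indices
-- give distinct relations, by the partition condition).
record RegularThinJordanScheme {c ℓ} (F : Field c ℓ) (n m : ℕ) : Set (c ⊔ ℓ) where
  open Field F using (Carrier; _≈_; _+_; _*_; 0#; 1#; _⁻¹)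
  open MatrixOps F
  field
    perm : Fin m → Permutation′ n
  -- the relation of s : {(ω, s ω)}
  field
    partition : ∀ α β → ∃! _≡_ (λ i → perm i ⟨$⟩ʳ α ≡ β)
    hasIdentity : ∃ λ i → ∀ ω → perm i ⟨$⟩ʳ ω ≡ ω
    hasInverses : ∀ i → ∃ λ j → ∀ ω → perm j ⟨$⟩ʳ ω ≡ perm i ⟨$⟩ˡ ω

  InSpan : Mat n → Set (c ⊔ ℓ)
  InSpan A = ∃ λ (coef : Fin m → Carrier) →
               A ≈M (λ α β → Σ[ m ] (λ i → coef i * permMat (perm i) α β))

  field
    jordanClosed : ∀ A B → InSpan A → InSpan B → InSpan (A ⋆ B)

  IsIdentity : Fin m → Set
  IsIdentity i = ∀ ω → perm i ⟨$⟩ʳ ω ≡ ω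

  IsTranspose : Fin m → Fin m → Set
  IsTranspose j i = ∀ ω → perm j ⟨$⟩ʳ ω ≡ perm i ⟨$⟩ˡ ω

  diamond : Fin n → Fin m → Fin m → Fin m
  diamond ω₀ a b = proj₁ (partition ω₀ (perm a ⟨$⟩ʳ (perm b ⟨$⟩ʳ ω₀)))

{-# OPTIONS --safe #-}
module Submission where

open import Defs
open import Level using (Level)
open import Data.Nat using (ℕ)
open import Data.Fin using (Fin)
open import Data.Fin.Permutation using (Permutation′; _⟨$⟩ʳ_; _⟨$⟩ˡ_; inverseˡ)
open import Data.Product using (∃!; _×_; _,_; proj₁; proj₂)
open import Relation.Binary.PropositionalEquality
  using (_≡_; refl; sym; trans; cong; module ≡-Reasoning)

module ThinPartition {n m : ℕ} (perm : Fin m → Permutation′ n)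
  (partition : ∀ α β → ∃! _≡_ (λ i → perm i ⟨$⟩ʳ α ≡ β)) where

  connecting : Fin n → Fin n → Fin m
  connecting α β = proj₁ (partition α β)

  connecting-sends : ∀ α β → perm (connecting α β) ⟨$⟩ʳ α ≡ β
  connecting-sends α β = proj₁ (proj₂ (partition α β))

  connecting-unique : ∀ {α β} i → perm i ⟨$⟩ʳ α ≡ β → connecting α β ≡ i
  connecting-unique i p = proj₂ (proj₂ (partition _ _)) p

  perm-determined-at : ∀ α {i j} → perm i ⟨$⟩ʳ α ≡ perm j ⟨$⟩ʳ α → i ≡ j
  perm-determined-at α {i} {j} p =
    trans (sym (connecting-unique i p)) (connecting-unique j refl)

  IsIdentity : Fin m → Set
  IsIdentity e = ∀ ω → perm e ⟨$⟩ʳ ω ≡ ω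

  IsTranspose : Fin m → Fin m → Set
  IsTranspose at a = ∀ ω → perm at ⟨$⟩ʳ ω ≡ perm a ⟨$⟩ˡ ω

  transpose-cancels : ∀ {a at} → IsTranspose at a →
                      ∀ ω → perm at ⟨$⟩ʳ (perm a ⟨$⟩ʳ ω) ≡ ω
  transpose-cancels {a} t ω = trans (t _) (inverseˡ (perm a))

  module Diamond (ω₀ : Fin n) where

    _⋄_ : Fin m → Fin m → Fin m
    a ⋄ b = connecting ω₀ (perm a ⟨$⟩ʳ (perm b ⟨$⟩ʳ ω₀))

    ⋄-sends : ∀ a b → perm (a ⋄ b) ⟨$⟩ʳ ω₀ ≡ perm a ⟨$⟩ʳ (perm b ⟨$⟩ʳ ω₀)
    ⋄-sends a b = connecting-sends ω₀ _

    ⋄-unique : ∀ {a b} c → perm c ⟨$⟩ʳ ω₀ ≡ perm a ⟨$⟩ʳ (perm b ⟨$⟩ʳ ω₀) → a ⋄ b ≡ c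
    ⋄-unique = connecting-unique

    module _ {e} (e-id : IsIdentity e) where

      ⋄-identityˡ : ∀ a → e ⋄ a ≡ a
      ⋄-identityˡ a = ⋄-unique a (sym (e-id _))

      ⋄-identityʳ : ∀ a → a ⋄ e ≡ a
      ⋄-identityʳ a = ⋄-unique a (cong (perm a ⟨$⟩ʳ_) (sym (e-id ω₀)))

    module _ {a at} (t : IsTranspose at a) where

      ⋄-inverseˡ : ∀ {e} → IsIdentity e → at ⋄ a ≡ e
      ⋄-inverseˡ {e} e-id = ⋄-unique e (trans (e-id ω₀) (sym (transpose-cancels t ω₀)))

      ⋄-inverseˡ-isIdentity : ∀ {e} → IsIdentity e → IsIdentity (at ⋄ a)
      ⋄-inverseˡ-isIdentity e-id ω =
        trans (cong (λ k → perm k ⟨$⟩ʳ ω) (⋄-inverseˡ e-id)) (e-id ω)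

      ⋄-cancel-transposeˡ : ∀ b → at ⋄ (a ⋄ b) ≡ b
      ⋄-cancel-transposeˡ b = ⋄-unique b (sym (begin
        perm at ⟨$⟩ʳ (perm (a ⋄ b) ⟨$⟩ʳ ω₀)        ≡⟨ cong (perm at ⟨$⟩ʳ_) (⋄-sends a b) ⟩
        perm at ⟨$⟩ʳ (perm a ⟨$⟩ʳ (perm b ⟨$⟩ʳ ω₀)) ≡⟨ transpose-cancels t _ ⟩
        perm b ⟨$⟩ʳ ω₀                              ∎))
        where open ≡-Reasoning

    ⋄-solvableˡ : ∀ a b → ∃! _≡_ (λ x → x ⋄ a ≡ b)
    ⋄-solvableˡ a b = x , ⋄-unique b (sym x-sends) , λ {y} y⋄a≡b →
      perm-determined-at (perm a ⟨$⟩ʳ ω₀) (begin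
        perm x ⟨$⟩ʳ (perm a ⟨$⟩ʳ ω₀) ≡⟨ x-sends ⟩
        perm b ⟨$⟩ʳ ω₀               ≡⟨ cong (λ k → perm k ⟨$⟩ʳ ω₀) (sym y⋄a≡b) ⟩
        perm (y ⋄ a) ⟨$⟩ʳ ω₀         ≡⟨ ⋄-sends y a ⟩
        perm y ⟨$⟩ʳ (perm a ⟨$⟩ʳ ω₀) ∎)
      where
      open ≡-Reasoning
      x = connecting (perm a ⟨$⟩ʳ ω₀) (perm b ⟨$⟩ʳ ω₀)
      x-sends : perm x ⟨$⟩ʳ (perm a ⟨$⟩ʳ ω₀) ≡ perm b ⟨$⟩ʳ ω₀
      x-sends = connecting-sends _ _

proposition3p7 : ∀ {c ℓ : Level} (F : Field c ℓ) → CharNot2 F →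
  ∀ {n m : ℕ} (X : RegularThinJordanScheme F n m) (ω₀ : Fin n) →
  let open RegularThinJordanScheme X
      _⋄_ = diamond ω₀
  in ((∀ e → IsIdentity e → ∀ a → (e ⋄ a ≡ a) × (a ⋄ e ≡ a))
     × (∀ a at → IsTranspose at a → IsIdentity (at ⋄ a))
     × (∀ a at b → IsTranspose at a → at ⋄ (a ⋄ b) ≡ b)
     × (∀ a b → ∃! _≡_ (λ x → x ⋄ a ≡ b)))
proposition3p7 F _ X ω₀ =
    (λ e e-id a → ⋄-identityˡ e-id a , ⋄-identityʳ e-id a)
  , (λ a at t → ⋄-inverseˡ-isIdentity t (proj₂ hasIdentity))
  , (λ a at b t → ⋄-cancel-transposeˡ t b)
  , ⋄-solvableˡ
  where
  open RegularThinJordanScheme X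
  open ThinPartition perm partition using (module Diamond)
  open Diamond ω₀
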